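{- Let $(S,\mathcal B)$ be a Steiner triple system of order $21$ with two different flowers $\{A,B,C,D\}$ and $\{A',B',C',D'\}$ with stems $D$ and $D'$, respectively. Then (i) $D\cap D'=\emptyset$; (ii) $D\cup E=D'\cup E'$ for some $E\in\{A,B,C\}$ and $E'\in\{A',B',C'\}$; (iii) $\mathcal B$ has a sub-STS$(9)$ with support $D\cup E$, where $E$ is as in (ii).
   Context: A Steiner triple system (STS) on $S$ is a set of 3-subsets (blocks) of $S$ such that any two distinct points lie in exactly one block; STS$(v)$ means $|S|=v$. A sub-STS$(9)$ of $\mathcal B$ is a subset of $\mathcal B$ forming an STS$(9)$ on some 9-set (its support). An almost-sub-STS of $\mathcal B$ is a subset of the form $\mathcal C'\setminus\{T\}$ where $\mathcal C'$ is an STS on some set (the support) and $T\in\mathcal C'$ (the missing triple, not necessarily in $\mathcal B$). For an STS$(21)$ $(S,\mathcal B)$, a partition of $S$ into sets $A,B,C,D$ of sizes $6,6,6,3$ is a flower with stem $D$ and petals $A,B,C$ if $\mathcal B$ contains one sub-STS$(9)$ and two almost-sub-STS$(9)$ whose supports are $A\cup D$, $B\cup D$, $C\cup D$ (in some order), where the missing triple of each of these two almost-sub-STS is $D$ (whether or not $D\in\mathcal B$). -}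

module Defs where

open import Data.Nat using (ℕ)
open import Data.Fin using (Fin)
open import Data.Fin.Subset using (Subset; _∈_; _⊆_; _∪_; _∩_; ∣_∣; ⊤; ⊥)
open import Data.Product using (Σ; ∃; ∃-syntax; _×_; _,_)
open import Data.Sum using (_⊎_)
open import Relation.Nullary using (¬_)
open import Relation.Binary.PropositionalEquality using (_≡_; _≢_)
open import Level using (Level; suc; zero)

Pt : Set
Pt = Fin 21

PSet : Set
PSet = Subset 21

Family : Set₁
Family = PSet → Set

IsSTS : PSet → Family → Set
IsSTS X 𝒞 =
  (∀ t → 𝒞 t → (∣ t ∣ ≡ 3 × t ⊆ X)) ×
  (∀ x y → x ∈ X → y ∈ X → x ≢ y →
     (∃[ t ] (𝒞 t × x ∈ t × y ∈ t)) ×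
     (∀ t u → 𝒞 t → x ∈ t → y ∈ t → 𝒞 u → x ∈ u → y ∈ u → t ≡ u))

IsSTS21 : Family → Set
IsSTS21 ℬ = IsSTS ⊤ ℬ

_⊑_ : Family → Family → Set
𝒞 ⊑ ℬ = ∀ t → 𝒞 t → ℬ t

HasSubSTS9 : Family → PSet → Set₁
HasSubSTS9 ℬ X = ∣ X ∣ ≡ 9 × (∃[ 𝒞 ] (𝒞 ⊑ ℬ × IsSTS X 𝒞))

_∖₁_ : Family → PSet → Family
(𝒞 ∖₁ T) t = 𝒞 t × t ≢ T

-- ℬ has an almost-sub-STS(9) with support X and missing triple T:
-- a subset of ℬ of the form 𝒞' ∖ {T} with (X , 𝒞') an STS(9) and T ∈ 𝒞'
-- (T need not belong to ℬ).
HasAlmostSubSTS9 : Family → PSet → PSet → Set₁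
HasAlmostSubSTS9 ℬ X T =
  ∣ X ∣ ≡ 9 × (∃[ 𝒞' ] (IsSTS X 𝒞' × 𝒞' T × (𝒞' ∖₁ T) ⊑ ℬ))

IsPartition6663 : PSet → PSet → PSet → PSet → Set
IsPartition6663 A B C D =
  (A ∪ (B ∪ (C ∪ D))) ≡ ⊤ ×
  (A ∩ B ≡ ⊥) × (A ∩ C ≡ ⊥) × (A ∩ D ≡ ⊥) ×
  (B ∩ C ≡ ⊥) × (B ∩ D ≡ ⊥) × (C ∩ D ≡ ⊥) ×
  ∣ A ∣ ≡ 6 × ∣ B ∣ ≡ 6 × ∣ C ∣ ≡ 6 × ∣ D ∣ ≡ 3

IsFlower : Family → PSet → PSet → PSet → PSet → Set₁
IsFlower ℬ A B C D =
  IsPartition6663 A B C D ×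
  ( (HasSubSTS9 ℬ (A ∪ D) × HasAlmostSubSTS9 ℬ (B ∪ D) D × HasAlmostSubSTS9 ℬ (C ∪ D) D)
  ⊎ (HasAlmostSubSTS9 ℬ (A ∪ D) D × HasSubSTS9 ℬ (B ∪ D) × HasAlmostSubSTS9 ℬ (C ∪ D) D)
  ⊎ (HasAlmostSubSTS9 ℬ (A ∪ D) D × HasAlmostSubSTS9 ℬ (B ∪ D) D × HasSubSTS9 ℬ (C ∪ D)))

_∈₃_ : PSet → PSet × PSet × PSet → Set
X ∈₃ (A , B , C) = X ≡ A ⊎ X ≡ B ⊎ X ≡ C

_∈₄_ : PSet → PSet × PSet × PSet × PSet → Set
X ∈₄ (A , B , C , D) = X ≡ A ⊎ X ≡ B ⊎ X ≡ C ⊎ X ≡ D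

SameParts : PSet × PSet × PSet × PSet → PSet × PSet × PSet × PSet → Set
SameParts P P' = ∀ X → (X ∈₄ P → X ∈₄ P') × (X ∈₄ P' → X ∈₄ P)

-- Label every point by the petal of the first flower {A,B,C,D} containing it, or as a
-- stem point. Each part P ∪ D is closed under x ∘ y (the third point of the block through x
-- and y) as soon as x ∉ D, which restricts the labels a block of ℬ can carry. A part Y of the
-- second flower supports an STS(9) all of whose blocks except at most one lie in ℬ; putting
-- AG(2,3) coordinates on it and checking all 4⁹ labellings shows that if Y meets D then Y ∖ D
-- lies in a single petal. If the stems met, this would force D′ = D and then equal flowers.
-- Otherwise the part of the second flower through a point of D is a part E ∪ D of the first
-- flower; it is closed under ∘ also on D, so its almost-sub-STS(9) is a sub-STS(9).
module Submission where

open import Defs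
open import Data.Bool using (Bool; true; T; not; _∧_; _∨_)
open import Data.Bool.ListAction using (all)
open import Data.Bool.Properties using (T-∧; T-≡) renaming (_≟_ to _≟ᵇ_)
open import Data.Nat using (ℕ; zero; suc; _≤_; _<_; _≤ᵇ_; z≤n; s≤s)
open import Data.Nat.Properties
  using (≤-trans; <-trans; <-≤-trans; ≤-reflexive; <-irrefl; m≤n⇒m≤1+n; ≤-pred; ≤⇒≤ᵇ; _<?_;
         module ≤-Reasoning)
open import Data.Fin using (Fin; zero; suc)
open import Data.Fin.Properties using (_≟_)
open import Data.Fin.Subset using (Subset; _∈_; _∉_; _⊆_; _∪_; _∩_; ∣_∣; _-_; ⁅_⁆; ⊥; inside; outside)
open import Data.Fin.Subset.Properties
  using (_∈?_; nonempty?; Empty-unique; ∣⊥∣≡0; p─⊥≡p; p─q⊆p; x∈p∧x≢y⇒x∈p-y; x∈p⇒∣p-x∣<∣p∣; p⊂q⇒∣p∣<∣q∣;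
         ⊆-antisym; ∈⊤; ∉⊥; x∈p∪q⁻; x∈p∩q⁺; x∈p∩q⁻; p⊆p∪q; q⊆p∪q; ∪-comm)
open import Data.List using (List; []; _∷_; _++_; _∷ʳ_; length; map; filter; allFin)
import Data.List as List
open import Data.List.Properties using (length-map)
open import Data.List.Membership.Propositional using () renaming (_∈_ to _∈ₗ_)
open import Data.List.Membership.Propositional.Properties using (∈-filter⁺; ∈-filter⁻; ∈-allFin; ∈-lookup)
open import Data.List.Relation.Unary.All as All using (All; []; _∷_)
import Data.List.Relation.Unary.All.Properties as All
open import Data.List.Relation.Unary.All.Properties using (¬Any⇒All¬; all⁺; all⁻)
open import Data.List.Relation.Unary.Any as Any using (Any; here; there; any?)
open import Data.List.Relation.Unary.Any.Properties using (lookup-index)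
open import Data.List.Relation.Unary.AllPairs using ([]; _∷_)
open import Data.List.Relation.Unary.Unique.Propositional using (Unique)
open import Data.List.Relation.Unary.Unique.Propositional.Properties using (++⁺; map⁺; filter⁺; allFin⁺)
open import Data.Vec using (Vec; []; _∷_; lookup; tabulate; here; there)
open import Data.Vec.Properties using (lookup∘tabulate; ≡-dec)
open import Data.Product using (∃-syntax; _×_; _,_; proj₁; proj₂)
open import Data.Sum using (_⊎_; inj₁; inj₂)
open import Data.Empty using (⊥-elim)
open import Function using (_∘_; Equivalence)
open import Relation.Nullary using (Dec; ¬_; yes; no; ¬?; contradiction)
open import Relation.Nullary.Decidable using (⌊_⌋; _×-dec_; _⊎-dec_; toWitness; fromWitness; from-yes)
open import Relation.Binary.PropositionalEquality
  using (_≡_; _≢_; refl; sym; trans; cong; subst; module ≡-Reasoning)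


-- Counting in finite sets

private variable
  n : ℕ

∣p∣≤1+∣p-x∣ : (p : Subset n) (x : Fin n) → ∣ p ∣ ≤ suc ∣ p - x ∣
∣p∣≤1+∣p-x∣ (inside ∷ p) zero = s≤s (≤-reflexive (cong ∣_∣ (sym (p─⊥≡p p))))
∣p∣≤1+∣p-x∣ (outside ∷ p) zero = m≤n⇒m≤1+n (≤-reflexive (cong ∣_∣ (sym (p─⊥≡p p))))
∣p∣≤1+∣p-x∣ (inside ∷ p) (suc x) = s≤s (∣p∣≤1+∣p-x∣ p x)
∣p∣≤1+∣p-x∣ (outside ∷ p) (suc x) = ∣p∣≤1+∣p-x∣ p x

x∉p-x : (p : Subset n) (x : Fin n) → x ∉ p - x
x∉p-x (s ∷ p) (suc x) (there x∈p-x) = x∉p-x p x x∈p-x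

length<∣∣⇒∃∉ : (X : Subset n) (xs : List (Fin n)) → length xs < ∣ X ∣ → ∃[ y ] (y ∈ X × All (y ≢_) xs)
length<∣∣⇒∃∉ {n} X [] 0<∣X∣ with nonempty? X
... | yes (y , y∈X) = y , y∈X , []
... | no X-empty = contradiction 0<∣X∣ (<-irrefl (sym (trans (cong ∣_∣ (Empty-unique X-empty)) (∣⊥∣≡0 n))))
length<∣∣⇒∃∉ X (x ∷ xs) lt with length<∣∣⇒∃∉ (X - x) xs (≤-pred (≤-trans lt (∣p∣≤1+∣p-x∣ X x)))
... | y , y∈X-x , y∉xs = y , p─q⊆p X ⁅ x ⁆ y∈X-x , (λ { refl → x∉p-x X x y∈X-x }) ∷ y∉xs

two-points : (X : Subset n) → 1 < ∣ X ∣ → ∃[ x ] ∃[ y ] (x ∈ X × y ∈ X × x ≢ y)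
two-points X 1<∣X∣ with length<∣∣⇒∃∉ X [] (<-trans (s≤s z≤n) 1<∣X∣)
... | x , x∈X , [] with length<∣∣⇒∃∉ X (x ∷ []) 1<∣X∣
... | y , y∈X , y≢x ∷ [] = x , y , x∈X , y∈X , y≢x ∘ sym

unique⇒length≤∣∣ : {X : Subset n} {xs : List (Fin n)} → Unique xs → All (_∈ X) xs → length xs ≤ ∣ X ∣
unique⇒length≤∣∣ [] [] = z≤n
unique⇒length≤∣∣ {X = X} (x≢xs ∷ xs-unique) (x∈X ∷ xs⊆X) =
  <-≤-trans (s≤s (unique⇒length≤∣∣ xs-unique xs⊆X-x)) (x∈p⇒∣p-x∣<∣p∣ x∈X)
  where
  xs⊆X-x = All.zipWith (λ (y∈X , x≢y) → x∈p∧x≢y⇒x∈p-y y∈X (x≢y ∘ sym)) (xs⊆X , x≢xs)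

unique-covers : {X : Subset n} {xs : List (Fin n)} → Unique xs → All (_∈ X) xs → ∣ X ∣ ≤ length xs →
                ∀ {y} → y ∈ X → y ∈ₗ xs
unique-covers {X = X} {xs = xs} xs-unique xs⊆X ∣X∣≤ {y} y∈X with any? (y ≟_) xs
... | yes y∈xs = y∈xs
... | no y∉xs = contradiction (≤-trans longer ∣X∣≤) (<-irrefl refl)
  where
  longer : suc (length xs) ≤ ∣ X ∣
  longer = unique⇒length≤∣∣ (¬Any⇒All¬ xs y∉xs ∷ xs-unique) (y∈X ∷ xs⊆X)

⊆∧∣∣≤⇒≡ : {p q : Subset n} → p ⊆ q → ∣ q ∣ ≤ ∣ p ∣ → p ≡ q
⊆∧∣∣≤⇒≡ {p = p} {q} p⊆q ∣q∣≤∣p∣ = ⊆-antisym p⊆q q⊆p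
  where
  q⊆p : q ⊆ p
  q⊆p {y} y∈q with y ∈? p
  ... | yes y∈p = y∈p
  ... | no y∉p = contradiction (≤-trans (p⊂q⇒∣p∣<∣q∣ (p⊆q , y , y∈q , y∉p)) ∣q∣≤∣p∣) (<-irrefl refl)

disjoint : {P Q : Subset n} {x : Fin n} → P ∩ Q ≡ ⊥ → x ∈ P → x ∉ Q
disjoint P∩Q≡⊥ x∈P x∈Q = ∉⊥ (subst (_ ∈_) P∩Q≡⊥ (x∈p∩q⁺ (x∈P , x∈Q)))

lookup-injective : ∀ {A : Set} {xs : List A} → Unique xs →
                   ∀ {i j} → List.lookup xs i ≡ List.lookup xs j → i ≡ j
lookup-injective (_ ∷ _) {zero} {zero} _ = refl
lookup-injective (x≢xs ∷ _) {zero} {suc j} e = contradiction e (All.lookup x≢xs (∈-lookup j))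
lookup-injective (x≢xs ∷ _) {suc i} {zero} e = contradiction (sym e) (All.lookup x≢xs (∈-lookup i))
lookup-injective (_ ∷ xs-unique) {suc i} {suc j} e = cong suc (lookup-injective xs-unique e)

another : (i : Fin (suc (suc n))) → ∃[ j ] j ≢ i
another zero = suc zero , λ ()
another (suc i) = zero , λ ()

-- Steiner triple systems

module SteinerTripleSystem {X : PSet} {𝒞 : Family} (sts : IsSTS X 𝒞) where

  private variable
    t u : PSet
    a b c r w x y z : Pt

  block-size : 𝒞 t → ∣ t ∣ ≡ 3
  block-size {t} t∈𝒞 = proj₁ (proj₁ sts t t∈𝒞)

  block⊆ : 𝒞 t → t ⊆ X
  block⊆ {t} t∈𝒞 = proj₂ (proj₁ sts t t∈𝒞)

  block-unique : x ∈ X → y ∈ X → x ≢ y →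
                 𝒞 t → x ∈ t → y ∈ t → 𝒞 u → x ∈ u → y ∈ u → t ≡ u
  block-unique {x} {y} x∈X y∈X x≢y = proj₂ (proj₂ sts x y x∈X y∈X x≢y) _ _

  block-members : 𝒞 t → a ∈ t → b ∈ t → c ∈ t → a ≢ b → a ≢ c → b ≢ c →
                  w ∈ t → w ≡ a ⊎ w ≡ b ⊎ w ≡ c
  block-members t∈𝒞 a∈t b∈t c∈t a≢b a≢c b≢c w∈t
    with unique-covers ((a≢b ∷ a≢c ∷ []) ∷ (b≢c ∷ []) ∷ [] ∷ []) (a∈t ∷ b∈t ∷ c∈t ∷ [])
                       (≤-reflexive (block-size t∈𝒞)) w∈t
  ... | here w≡a = inj₁ w≡a
  ... | there (here w≡b) = inj₂ (inj₁ w≡b)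
  ... | there (there (here w≡c)) = inj₂ (inj₂ w≡c)

  ThirdPoint : Pt → Pt → Pt → Set
  ThirdPoint x y z = (∃[ t ] (𝒞 t × x ∈ t × y ∈ t × z ∈ t)) × z ≢ x × z ≢ y

  third-point : x ∈ X → y ∈ X → x ≢ y → ∃[ z ] ThirdPoint x y z
  third-point {x} {y} x∈X y∈X x≢y with proj₁ (proj₂ sts x y x∈X y∈X x≢y)
  ... | t , t∈𝒞 , x∈t , y∈t
    with length<∣∣⇒∃∉ t (x ∷ y ∷ []) (≤-reflexive (sym (block-size t∈𝒞)))
  ... | z , z∈t , z≢x ∷ z≢y ∷ [] = z , (t , t∈𝒞 , x∈t , y∈t , z∈t) , z≢x , z≢y

  -- Junk value x unless x and y are distinct points of X.
  third : Pt → Pt → Pt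
  third x y with x ∈? X | y ∈? X | x ≟ y
  ... | yes x∈X | yes y∈X | no x≢y = proj₁ (third-point x∈X y∈X x≢y)
  ... | _ | _ | _ = x

  third-spec : x ∈ X → y ∈ X → x ≢ y → ThirdPoint x y (third x y)
  third-spec {x} {y} x∈X y∈X x≢y with x ∈? X | y ∈? X | x ≟ y
  ... | yes x∈X′ | yes y∈X′ | no x≢y′ = proj₂ (third-point x∈X′ y∈X′ x≢y′)
  ... | no x∉X | _ | _ = contradiction x∈X x∉X
  ... | yes _ | no y∉X | _ = contradiction y∈X y∉X
  ... | yes _ | yes _ | yes x≡y = contradiction x≡y x≢y

  module _ (x∈X : x ∈ X) (y∈X : y ∈ X) (x≢y : x ≢ y) where

    third∈ : third x y ∈ X
    third∈ with third-spec x∈X y∈X x≢y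
    ... | (t , t∈𝒞 , _ , _ , z∈t) , _ = block⊆ t∈𝒞 z∈t

    third≢ˡ : third x y ≢ x
    third≢ˡ = proj₁ (proj₂ (third-spec x∈X y∈X x≢y))

    third≢ʳ : third x y ≢ y
    third≢ʳ = proj₂ (proj₂ (third-spec x∈X y∈X x≢y))

  third-unique : 𝒞 t → x ∈ t → y ∈ t → w ∈ t → x ≢ y → w ≢ x → w ≢ y → third x y ≡ w
  third-unique t∈𝒞 x∈t y∈t w∈t x≢y w≢x w≢y
    with third-spec (block⊆ t∈𝒞 x∈t) (block⊆ t∈𝒞 y∈t) x≢y
  ... | (u , u∈𝒞 , x∈u , y∈u , z∈u) , z≢x , z≢y
    with block-unique (block⊆ t∈𝒞 x∈t) (block⊆ t∈𝒞 y∈t) x≢y u∈𝒞 x∈u y∈u t∈𝒞 x∈t y∈t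
  ... | refl with block-members u∈𝒞 x∈u y∈u z∈u x≢y (z≢x ∘ sym) (z≢y ∘ sym) w∈t
  ... | inj₁ w≡x = contradiction w≡x w≢x
  ... | inj₂ (inj₁ w≡y) = contradiction w≡y w≢y
  ... | inj₂ (inj₂ w≡z) = sym w≡z

  third∈block : 𝒞 t → x ∈ t → y ∈ t → x ≢ y → third x y ∈ t
  third∈block t∈𝒞 x∈t y∈t x≢y
    with third-spec (block⊆ t∈𝒞 x∈t) (block⊆ t∈𝒞 y∈t) x≢y
  ... | (u , u∈𝒞 , x∈u , y∈u , z∈u) , _
    with block-unique (block⊆ t∈𝒞 x∈t) (block⊆ t∈𝒞 y∈t) x≢y u∈𝒞 x∈u y∈u t∈𝒞 x∈t y∈t
  ... | refl = z∈u

  module _ (x∈X : x ∈ X) (y∈X : y ∈ X) (x≢y : x ≢ y) where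

    third-comm : third x y ≡ third y x
    third-comm with third-spec x∈X y∈X x≢y
    ... | (t , t∈𝒞 , x∈t , y∈t , z∈t) , z≢x , z≢y =
      sym (third-unique t∈𝒞 y∈t x∈t z∈t (x≢y ∘ sym) z≢y z≢x)

    third-involutive : third x (third x y) ≡ y
    third-involutive with third-spec x∈X y∈X x≢y
    ... | (t , t∈𝒞 , x∈t , y∈t , z∈t) , z≢x , z≢y =
      third-unique t∈𝒞 x∈t z∈t y∈t (z≢x ∘ sym) (x≢y ∘ sym) (z≢y ∘ sym)

    third-move : third x y ≡ z → third x z ≡ y
    third-move refl = third-involutive

  third-cancelˡ : x ∈ X → y ∈ X → z ∈ X → x ≢ y → x ≢ z → third x y ≡ third x z → y ≡ z
  third-cancelˡ {x} {y} {z} x∈X y∈X z∈X x≢y x≢z e = begin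
    y                    ≡⟨ third-involutive x∈X y∈X x≢y ⟨
    third x (third x y)  ≡⟨ cong (third x) e ⟩
    third x (third x z)  ≡⟨ third-involutive x∈X z∈X x≢z ⟩
    z                    ∎
    where open ≡-Reasoning

  module _ (a∈X : a ∈ X) (r∈X : r ∈ X) (a≢r : a ≢ r) where

    third-off-line : third a b ≡ c → r ≢ c → third a r ≢ b
    third-off-line third-ab r≢c third-ar = r≢c (trans (sym (third-move a∈X r∈X a≢r third-ar)) third-ab)

  third-pencil : a ∈ X → b ∈ X → r ∈ X → a ≢ b → r ≢ a → r ≢ b → third a r ≢ third b r
  third-pencil {a} {b} {r} a∈X b∈X r∈X a≢b r≢a r≢b e = a≢b (third-cancelˡ r∈X a∈X b∈X r≢a r≢b (begin
    third r a  ≡⟨ third-comm a∈X r∈X (r≢a ∘ sym) ⟨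
    third a r  ≡⟨ e ⟩
    third b r  ≡⟨ third-comm b∈X r∈X (r≢b ∘ sym) ⟩
    third r b  ∎))
    where open ≡-Reasoning

module _ {X Y : PSet} {𝒞 𝒟 : Family} (𝒞-sts : IsSTS X 𝒞) (𝒟-sts : IsSTS Y 𝒟) where
  private
    module C = SteinerTripleSystem 𝒞-sts
    module D = SteinerTripleSystem 𝒟-sts

  third-inherited : ∀ {x y} → x ∈ X → y ∈ X → x ≢ y → (∀ t → 𝒞 t → x ∈ t → 𝒟 t) →
                    D.third x y ≡ C.third x y
  third-inherited x∈X y∈X x≢y 𝒞⊑𝒟 with C.third-spec x∈X y∈X x≢y
  ... | (t , t∈𝒞 , x∈t , y∈t , z∈t) , z≢x , z≢y =
    D.third-unique (𝒞⊑𝒟 t t∈𝒞 x∈t) x∈t y∈t z∈t x≢y z≢x z≢y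

-- Labellings of the affine plane AG(2,3)

data Label : Set where
  stem  : Label
  petal : Fin 3 → Label

petal-injective : ∀ {i j} → petal i ≡ petal j → i ≡ j
petal-injective refl = refl

isStem? : ∀ ℓ → Dec (ℓ ≡ stem)
isStem? stem = yes refl
isStem? (petal _) = no λ ()

InPart : Fin 3 → Label → Set
InPart i ℓ = ℓ ≡ stem ⊎ ℓ ≡ petal i

Closed : Label → Label → Label → Set
Closed ℓ₁ ℓ₂ ℓ₃ = ∀ {i} → ℓ₁ ≡ petal i → InPart i ℓ₂ → InPart i ℓ₃

BlockClosed : Label → Label → Label → Set
BlockClosed ℓ₁ ℓ₂ ℓ₃ =
  Closed ℓ₁ ℓ₂ ℓ₃ × Closed ℓ₁ ℓ₃ ℓ₂ × Closed ℓ₂ ℓ₁ ℓ₃ × Closed ℓ₂ ℓ₃ ℓ₁ × Closed ℓ₃ ℓ₁ ℓ₂ × Closed ℓ₃ ℓ₂ ℓ₁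

sharePartᵇ : Label → Label → Bool
sharePartᵇ stem _ = true
sharePartᵇ (petal _) stem = true
sharePartᵇ (petal i) (petal j) = ⌊ i ≟ j ⌋

-- The label patterns of a block of ℬ that are compatible with every part being closed.
lineOkᵇ : Label → Label → Label → Bool
lineOkᵇ stem y w = sharePartᵇ y w
lineOkᵇ x stem w = sharePartᵇ x w
lineOkᵇ x y stem = sharePartᵇ x y
lineOkᵇ (petal i) (petal j) (petal k) =
  (⌊ i ≟ j ⌋ ∧ ⌊ j ≟ k ⌋) ∨ (not ⌊ i ≟ j ⌋ ∧ not ⌊ j ≟ k ⌋ ∧ not ⌊ i ≟ k ⌋)

sharePartᵇ-intro : ∀ {x y} → Closed x stem y → T (sharePartᵇ x y)
sharePartᵇ-intro {stem} _ = _
sharePartᵇ-intro {petal i} {stem} _ = _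
sharePartᵇ-intro {petal i} {petal j} closed with closed refl (inj₁ refl)
... | inj₂ refl = fromWitness {a? = i ≟ i} refl

sharePartᵇ-sound : ∀ {x y} → T (sharePartᵇ x y) → x ≢ stem → y ≢ stem → x ≡ y
sharePartᵇ-sound {stem} _ x≢stem _ = contradiction refl x≢stem
sharePartᵇ-sound {petal i} {stem} _ _ y≢stem = contradiction refl y≢stem
sharePartᵇ-sound {petal i} {petal j} i≡j _ _ with toWitness i≡j
... | refl = refl

lineOkᵇ-intro : ∀ x y w → BlockClosed x y w → T (lineOkᵇ x y w)
lineOkᵇ-intro stem y w (_ , _ , yxw , _) = sharePartᵇ-intro λ y≡ _ → yxw y≡ (inj₁ refl)
lineOkᵇ-intro (petal i) stem w (xyw , _) = sharePartᵇ-intro λ x≡ _ → xyw x≡ (inj₁ refl)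
lineOkᵇ-intro (petal i) (petal j) stem (_ , xwy , _) = sharePartᵇ-intro λ x≡ _ → xwy x≡ (inj₁ refl)
lineOkᵇ-intro (petal i) (petal j) (petal k) (xyw , xwy , _ , ywx , _)
  with i ≟ j | j ≟ k | i ≟ k
... | yes refl | yes refl | _ = _
... | yes refl | no j≢k | _ with xyw refl (inj₂ refl)
...   | inj₂ refl = contradiction refl j≢k
lineOkᵇ-intro (petal i) (petal j) (petal k) (_ , _ , _ , ywx , _) | no i≢j | yes refl | _
  with ywx refl (inj₂ refl)
... | inj₂ refl = contradiction refl i≢j
lineOkᵇ-intro (petal i) (petal j) (petal k) (_ , xwy , _) | no i≢j | no _ | yes refl
  with xwy refl (inj₂ refl)
... | inj₂ refl = contradiction refl i≢j
lineOkᵇ-intro (petal i) (petal j) (petal k) _ | no _ | no _ | no _ = _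

Triple : Set
Triple = Fin 9 × Fin 9 × Fin 9

pt₀ pt₁ pt₂ pt₃ pt₄ pt₅ pt₆ pt₇ pt₈ : Fin 9
pt₀ = zero
pt₁ = suc zero
pt₂ = suc (suc zero)
pt₃ = suc (suc (suc zero))
pt₄ = suc (suc (suc (suc zero)))
pt₅ = suc (suc (suc (suc (suc zero))))
pt₆ = suc (suc (suc (suc (suc (suc zero)))))
pt₇ = suc (suc (suc (suc (suc (suc (suc zero))))))
pt₈ = suc (suc (suc (suc (suc (suc (suc (suc zero)))))))

_∈ᵗ_ : Fin 9 → Triple → Set
k ∈ᵗ (a , b , c) = k ≡ a ⊎ k ≡ b ⊎ k ≡ c

_∈ᵗ?_ : ∀ k t → Dec (k ∈ᵗ t)
k ∈ᵗ? (a , b , c) = k ≟ a ⊎-dec k ≟ b ⊎-dec k ≟ c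

Distinct : Triple → Set
Distinct (a , b , c) = a ≢ b × a ≢ c × b ≢ c

distinct? : ∀ t → Dec (Distinct t)
distinct? (a , b , c) = ¬? (a ≟ b) ×-dec ¬? (a ≟ c) ×-dec ¬? (b ≟ c)

special : Triple
special = (pt₀ , pt₁ , pt₂)

-- Point i of AG(2,3) is the i-th of (0,0) (1,0) (2,0) (0,1) (0,2) (2,2) (1,2) (1,1) (2,1);
-- lines are the triples of points summing to zero.
planeLines : List Triple
planeLines =
  (pt₀ , pt₃ , pt₄) ∷ (pt₁ , pt₃ , pt₅) ∷ (pt₂ , pt₃ , pt₆) ∷ (pt₃ , pt₇ , pt₈) ∷
  (pt₀ , pt₅ , pt₇) ∷ (pt₀ , pt₆ , pt₈) ∷ (pt₁ , pt₈ , pt₄) ∷ (pt₂ , pt₇ , pt₄) ∷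
  (pt₂ , pt₈ , pt₅) ∷ (pt₄ , pt₅ , pt₆) ∷ (pt₆ , pt₇ , pt₁) ∷ []

affineLines : List Triple
affineLines = special ∷ planeLines

OffSpecial : Triple → Set
OffSpecial (a , b , c) = ¬ (a ∈ᵗ special × b ∈ᵗ special × c ∈ᵗ special)

planeLines-valid : All (λ t → Distinct t × OffSpecial t) planeLines
planeLines-valid = from-yes (All.all? valid? planeLines)
  where
  valid? : ∀ t → Dec (Distinct t × OffSpecial t)
  valid? t@(a , b , c) = distinct? t ×-dec ¬? (a ∈ᵗ? special ×-dec b ∈ᵗ? special ×-dec c ∈ᵗ? special)


module Labelling (v : Vec Label 9) where

  lineOk : Triple → Bool
  lineOk (a , b , c) = lineOkᵇ (lookup v a) (lookup v b) (lookup v c)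

  stems : List (Fin 9)
  stems = filter (λ i → isStem? (lookup v i)) (allFin 9)

  admissibleᵇ : Bool
  admissibleᵇ = all lineOk planeLines ∧ (1 ≤ᵇ length stems) ∧ (length stems ≤ᵇ 3)

  sharePartAt : Fin 9 → Fin 9 → Bool
  sharePartAt i j = sharePartᵇ (lookup v i) (lookup v j)

  uniformᵇ : Bool
  uniformᵇ = all (λ i → all (sharePartAt i) (allFin 9)) (allFin 9)

open Labelling public

allVecs : ∀ n → (Vec Label n → Bool) → Bool
allVecs zero P = P []
allVecs (suc n) P =
  allVecs n (λ v → P (stem ∷ v)) ∧ allVecs n (λ v → P (petal zero ∷ v)) ∧
  allVecs n (λ v → P (petal (suc zero) ∷ v)) ∧ allVecs n (λ v → P (petal (suc (suc zero)) ∷ v))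

∧-elim : ∀ x {y} → T (x ∧ y) → T x × T y
∧-elim x = Equivalence.to (T-∧ {x})

allVecs-sound : ∀ n P → allVecs n P ≡ true → ∀ v → T (P v)
allVecs-sound n P holds = sound n P (Equivalence.from T-≡ holds)
  where
  sound : ∀ n P → T (allVecs n P) → ∀ v → T (P v)
  sound zero P t [] = t
  sound (suc n) P t (ℓ ∷ v) with ∧-elim (allVecs n (λ v → P (stem ∷ v))) t
  ... | t₀ , t₁₂₃ with ∧-elim (allVecs n (λ v → P (petal zero ∷ v))) t₁₂₃
  ... | t₁ , t₂₃ with ∧-elim (allVecs n (λ v → P (petal (suc zero) ∷ v))) t₂₃
  ... | t₂ , t₃ with ℓ
  ... | stem = sound n _ t₀ v
  ... | petal zero = sound n _ t₁ v
  ... | petal (suc zero) = sound n _ t₂ v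
  ... | petal (suc (suc zero)) = sound n _ t₃ v

labelling-check : ∀ v → T (not (admissibleᵇ v) ∨ uniformᵇ v)
labelling-check = allVecs-sound 9 (λ v → not (admissibleᵇ v) ∨ uniformᵇ v) exhaustive
  where
  exhaustive : allVecs 9 (λ v → not (admissibleᵇ v) ∨ uniformᵇ v) ≡ true
  exhaustive = refl

∈⇒1≤length : ∀ {A : Set} {x : A} {xs} → x ∈ₗ xs → 1 ≤ length xs
∈⇒1≤length (here _) = s≤s z≤n
∈⇒1≤length (there _) = s≤s z≤n

uniform-labelling : (v : Vec Label 9) → All (T ∘ lineOk v) planeLines →
                    (∃[ k ] lookup v k ≡ stem) → length (stems v) ≤ 3 →
                    ∀ i j → lookup v i ≢ stem → lookup v j ≢ stem → lookup v i ≡ lookup v j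
uniform-labelling v lines-ok (k , k-stem) few-stems i j i-petal j-petal =
  sharePartᵇ-sound (uniform-at i j) i-petal j-petal
  where
  lookup-all : (p : Fin 9 → Bool) → T (all p (allFin 9)) → ∀ i → T (p i)
  lookup-all p t i = All.lookup (all⁺ p (allFin 9) t) (∈-allFin i)
  some-stem : 1 ≤ length (stems v)
  some-stem = ∈⇒1≤length (∈-filter⁺ (λ i → isStem? (lookup v i)) (∈-allFin k) k-stem)
  admissible : T (admissibleᵇ v)
  admissible = Equivalence.from T-∧ (all⁻ (lineOk v) lines-ok ,
                 Equivalence.from T-∧ (≤⇒≤ᵇ some-stem , ≤⇒≤ᵇ few-stems))
  modus-ponens : ∀ a {b} → T a → T (not a ∨ b) → T b
  modus-ponens true _ t = t
  uniform : T (uniformᵇ v)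
  uniform = modus-ponens (admissibleᵇ v) admissible (labelling-check v)
  uniform-at : ∀ i j → T (sharePartAt v i j)
  uniform-at i = lookup-all (sharePartAt v i) (lookup-all (λ i → all (sharePartAt v i) (allFin 9)) uniform i)

-- Coordinates on an STS(9)

-- t is a block through a and k avoiding b, so the third point of a and b is not k.
Refutes : Fin 9 → Fin 9 → Fin 9 → Triple → Set
Refutes a b k t = Distinct t × a ∈ᵗ t × k ∈ᵗ t × ¬ b ∈ᵗ t

Excluded : List Triple → Fin 9 → Fin 9 → Fin 9 → Set
Excluded known a b k = k ≡ a ⊎ k ≡ b ⊎ Any (Refutes a b k) known ⊎ Any (Refutes b a k) known

excluded? : ∀ known a b k → Dec (Excluded known a b k)
excluded? known a b k =
  k ≟ a ⊎-dec k ≟ b ⊎-dec any? (refutes? a b) known ⊎-dec any? (refutes? b a) known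
  where
  refutes? : ∀ a b t → Dec (Refutes a b k t)
  refutes? a b t = distinct? t ×-dec a ∈ᵗ? t ×-dec k ∈ᵗ? t ×-dec ¬? (b ∈ᵗ? t)

candidates : List Triple → Fin 9 → Fin 9 → List (Fin 9)
candidates known a b = filter (¬? ∘ excluded? known a b) (allFin 9)

module AffinePlane {Y : PSet} {𝒦 : Family} (𝒦-sts : IsSTS Y 𝒦) (∣Y∣≡9 : ∣ Y ∣ ≡ 9) where
  open SteinerTripleSystem 𝒦-sts

  fewer-than-9 : ∀ {m} → m < 9 → m < ∣ Y ∣
  fewer-than-9 {m} = subst (m <_) (sym ∣Y∣≡9)

  Collinear : (Fin 9 → Pt) → Triple → Set
  Collinear σ (a , b , c) = ∃[ u ] (𝒦 u × σ a ∈ u × σ b ∈ u × σ c ∈ u)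

  module Forcing (σ : Fin 9 → Pt) (σ∈Y : ∀ i → σ i ∈ Y)
                 (σ-injective : ∀ {i j} → σ i ≡ σ j → i ≡ j) (σ-onto : ∀ {y} → y ∈ Y → ∃[ i ] σ i ≡ y) where

    σ-≢ : ∀ {i j} → i ≢ j → σ i ≢ σ j
    σ-≢ i≢j = i≢j ∘ σ-injective

    refutation-sound : ∀ {a b k t} → Collinear σ t → Refutes a b k t → a ≢ b → σ k ≢ third (σ a) (σ b)
    refutation-sound {a} {b} {k} {t₁ , t₂ , t₃} (u , u∈𝒦 , t₁∈u , t₂∈u , t₃∈u)
                     ((t₁≢t₂ , t₁≢t₃ , t₂≢t₃) , a∈t , k∈t , b∉t) a≢b σk≡ with a ≟ k
    ... | yes refl = third≢ˡ (σ∈Y a) (σ∈Y b) (σ-≢ a≢b) (sym σk≡)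
    ... | no a≢k = b∉t (members (block-members u∈𝒦 t₁∈u t₂∈u t₃∈u (σ-≢ t₁≢t₂) (σ-≢ t₁≢t₃) (σ-≢ t₂≢t₃) σb∈u))
      where
      ∈u : ∀ {i} → i ∈ᵗ (t₁ , t₂ , t₃) → σ i ∈ u
      ∈u (inj₁ refl) = t₁∈u
      ∈u (inj₂ (inj₁ refl)) = t₂∈u
      ∈u (inj₂ (inj₂ refl)) = t₃∈u
      σb∈u : σ b ∈ u
      σb∈u = subst (_∈ u) (third-move (σ∈Y a) (σ∈Y b) (σ-≢ a≢b) (sym σk≡))
                   (third∈block u∈𝒦 (∈u a∈t) (∈u k∈t) (σ-≢ a≢k))
      members : σ b ≡ σ t₁ ⊎ σ b ≡ σ t₂ ⊎ σ b ≡ σ t₃ → b ∈ᵗ (t₁ , t₂ , t₃)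
      members (inj₁ e) = inj₁ (σ-injective e)
      members (inj₂ (inj₁ e)) = inj₂ (inj₁ (σ-injective e))
      members (inj₂ (inj₂ e)) = inj₂ (inj₂ (σ-injective e))

    third-candidate : ∀ {known a b} → All (Collinear σ) known → a ≢ b →
                      ∃[ k ] (σ k ≡ third (σ a) (σ b) × k ∈ₗ candidates known a b)
    third-candidate {known} {a} {b} lines a≢b with σ-onto (third∈ (σ∈Y a) (σ∈Y b) (σ-≢ a≢b))
    ... | k , σk≡ = k , σk≡ , ∈-filter⁺ (¬? ∘ excluded? known a b) (∈-allFin k) not-excluded
      where
      not-excluded : ¬ Excluded known a b k
      not-excluded (inj₁ refl) = third≢ˡ (σ∈Y a) (σ∈Y b) (σ-≢ a≢b) (sym σk≡)
      not-excluded (inj₂ (inj₁ refl)) = third≢ʳ (σ∈Y a) (σ∈Y b) (σ-≢ a≢b) (sym σk≡)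
      not-excluded (inj₂ (inj₂ (inj₁ refutation))) with All.lookupAny lines refutation
      ... | collinear , refutes = refutation-sound collinear refutes a≢b σk≡
      not-excluded (inj₂ (inj₂ (inj₂ refutation))) with All.lookupAny lines refutation
      ... | collinear , refutes =
        refutation-sound collinear refutes (a≢b ∘ sym) (trans σk≡ (third-comm (σ∈Y a) (σ∈Y b) (σ-≢ a≢b)))

    collinear-third : ∀ {a b k} → a ≢ b → σ k ≡ third (σ a) (σ b) → Collinear σ (a , b , k)
    collinear-third {a} {b} a≢b σk≡ with third-spec (σ∈Y a) (σ∈Y b) (σ-≢ a≢b)
    ... | (u , u∈𝒦 , a∈u , b∈u , ab∈u) , _ = u , u∈𝒦 , a∈u , b∈u , subst (_∈ u) (sym σk≡) ab∈u

    forced : ∀ {known a b c} → All (Collinear σ) known → a ≢ b →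
             candidates known a b ≡ c ∷ [] → Collinear σ (a , b , c)
    forced lines a≢b only-c with third-candidate lines a≢b
    ... | k , σk≡ , k∈ rewrite only-c with k∈
    ... | here refl = collinear-third a≢b σk≡

    no-third : ∀ {known a b} → All (Collinear σ) known → a ≢ b → candidates known a b ≢ []
    no-third lines a≢b none with third-candidate lines a≢b
    ... | k , _ , k∈ rewrite none with k∈
    ... | ()

  record AffineCoordinates (p q : Pt) : Set where
    field
      σ : Fin 9 → Pt
      σ∈Y : ∀ i → σ i ∈ Y
      σ-injective : ∀ {i j} → σ i ≡ σ j → i ≡ j
      σ-onto : ∀ {y} → y ∈ Y → ∃[ i ] σ i ≡ y
      σ₀ : σ pt₀ ≡ p
      σ₁ : σ pt₁ ≡ q
      σ₂ : σ pt₂ ≡ third p q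
      lines : All (Collinear σ) affineLines

  -- The special line p, q, pq; a point r off it; the third points pr, qr, pqr of r with the
  -- special line; and the two remaining points u, v.
  module Construction {p q r : Pt} (p∈Y : p ∈ Y) (q∈Y : q ∈ Y) (r∈Y : r ∈ Y)
                      (p≢q : p ≢ q) (r∉pq : All (r ≢_) (p ∷ q ∷ third p q ∷ [])) where

    pq = third p q
    pr = third p r
    qr = third q r
    pqr = third pq r

    seven : List Pt
    seven = p ∷ q ∷ pq ∷ r ∷ pr ∷ qr ∷ pqr ∷ []

    private
      r≢p = All.lookup r∉pq (here refl)
      r≢q = All.lookup r∉pq (there (here refl))
      r≢pq = All.lookup r∉pq (there (there (here refl)))
      pq∈Y = third∈ p∈Y q∈Y p≢q
      p≢r = r≢p ∘ sym
      q≢r = r≢q ∘ sym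
      pq≢r = r≢pq ∘ sym
      p≢pq = third≢ˡ p∈Y q∈Y p≢q ∘ sym
      q≢pq = third≢ʳ p∈Y q∈Y p≢q ∘ sym
      q-p : third q p ≡ pq
      q-p = third-comm q∈Y p∈Y (p≢q ∘ sym)
      p-pq : third p pq ≡ q
      p-pq = third-involutive p∈Y q∈Y p≢q
      q-pq : third q pq ≡ p
      q-pq = trans (cong (third q) (sym q-p)) (third-involutive q∈Y p∈Y (p≢q ∘ sym))
      pq-p : third pq p ≡ q
      pq-p = trans (third-comm pq∈Y p∈Y (p≢pq ∘ sym)) p-pq
      pq-q : third pq q ≡ p
      pq-q = trans (third-comm pq∈Y q∈Y (q≢pq ∘ sym)) q-pq

    seven⊆Y : All (_∈ Y) seven
    seven⊆Y = p∈Y ∷ q∈Y ∷ pq∈Y ∷ r∈Y ∷ third∈ p∈Y r∈Y p≢r ∷ third∈ q∈Y r∈Y q≢r ∷ third∈ pq∈Y r∈Y pq≢r ∷ []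

    seven-unique : Unique seven
    seven-unique =
      (p≢q ∷ p≢pq ∷ p≢r ∷ third≢ˡ p∈Y r∈Y p≢r ∘ sym ∷ third-off-line q∈Y r∈Y q≢r q-p r≢pq ∘ sym ∷
        third-off-line pq∈Y r∈Y pq≢r pq-p r≢q ∘ sym ∷ []) ∷
      (q≢pq ∷ q≢r ∷ third-off-line p∈Y r∈Y p≢r refl r≢pq ∘ sym ∷ third≢ˡ q∈Y r∈Y q≢r ∘ sym ∷
        third-off-line pq∈Y r∈Y pq≢r pq-q r≢p ∘ sym ∷ []) ∷
      (pq≢r ∷ third-off-line p∈Y r∈Y p≢r p-pq r≢q ∘ sym ∷ third-off-line q∈Y r∈Y q≢r q-pq r≢p ∘ sym ∷
        third≢ˡ pq∈Y r∈Y pq≢r ∘ sym ∷ []) ∷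
      (third≢ʳ p∈Y r∈Y p≢r ∘ sym ∷ third≢ʳ q∈Y r∈Y q≢r ∘ sym ∷ third≢ʳ pq∈Y r∈Y pq≢r ∘ sym ∷ []) ∷
      (third-pencil p∈Y q∈Y r∈Y p≢q r≢p r≢q ∷ third-pencil p∈Y pq∈Y r∈Y p≢pq r≢p r≢pq ∷ []) ∷
      (third-pencil q∈Y pq∈Y r∈Y q≢pq r≢q r≢pq ∷ []) ∷
      [] ∷ []

    pencil-lines : List Triple
    pencil-lines =
      (pt₀ , pt₁ , pt₂) ∷ (pt₀ , pt₃ , pt₄) ∷ (pt₁ , pt₃ , pt₅) ∷ (pt₂ , pt₃ , pt₆) ∷ (pt₃ , pt₇ , pt₈) ∷ []

    module Frame {u v : Pt} (u∈Y : u ∈ Y) (v∈Y : v ∈ Y)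
                 (u∉seven : All (u ≢_) seven) (v∉seven : All (v ≢_) seven) (u≢v : u ≢ v) where

      points : List Pt
      points = seven ++ u ∷ v ∷ []

      σ : Fin 9 → Pt
      σ = List.lookup points

      points-unique : Unique points
      points-unique = ++⁺ seven-unique ((u≢v ∷ []) ∷ [] ∷ []) seven∩uv
        where
        seven∩uv : ∀ {w} → ¬ (w ∈ₗ seven × w ∈ₗ u ∷ v ∷ [])
        seven∩uv (w∈seven , here refl) = All.lookup u∉seven w∈seven refl
        seven∩uv (w∈seven , there (here refl)) = All.lookup v∉seven w∈seven refl

      points⊆Y : All (_∈ Y) points
      points⊆Y = All.++⁺ seven⊆Y (u∈Y ∷ v∈Y ∷ [])

      σ∈Y : ∀ i → σ i ∈ Y
      σ∈Y i = All.lookup points⊆Y (∈-lookup i)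

      σ-injective : ∀ {i j} → σ i ≡ σ j → i ≡ j
      σ-injective = lookup-injective points-unique

      σ-onto : ∀ {y} → y ∈ Y → ∃[ i ] σ i ≡ y
      σ-onto y∈Y with unique-covers points-unique points⊆Y (≤-reflexive ∣Y∣≡9) y∈Y
      ... | y∈points = Any.index y∈points , sym (lookup-index y∈points)

      open Forcing σ σ∈Y σ-injective σ-onto public

      extend : ∀ {known} → All (Collinear σ) known → ∀ a b → a ≢ b → ∀ {c} →
               candidates known a b ≡ c ∷ [] → All (Collinear σ) (known ∷ʳ (a , b , c))
      extend lines a b a≢b only-c = All.∷ʳ⁺ lines (forced lines a≢b only-c)

      pencil-of-r : All (Collinear σ) pencil-lines
      pencil-of-r = extend defining pt₃ pt₇ (λ ()) refl
        where
        defining : All (Collinear σ) ((pt₀ , pt₁ , pt₂) ∷ (pt₀ , pt₃ , pt₄) ∷ (pt₁ , pt₃ , pt₅) ∷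
                                      (pt₂ , pt₃ , pt₆) ∷ [])
        defining =
          collinear-third {pt₀} {pt₁} {pt₂} (λ ()) refl ∷ collinear-third {pt₀} {pt₃} {pt₄} (λ ()) refl ∷
          collinear-third {pt₁} {pt₃} {pt₅} (λ ()) refl ∷ collinear-third {pt₂} {pt₃} {pt₆} (λ ()) refl ∷ []

      complete : Collinear σ (pt₀ , pt₅ , pt₇) → AffineCoordinates p q
      complete line₀₅₇ = record
        { σ = σ ; σ∈Y = σ∈Y ; σ-injective = σ-injective ; σ-onto = σ-onto
        ; σ₀ = refl ; σ₁ = refl ; σ₂ = refl
        ; lines = all-lines }
        where
        all-lines =
          extend (extend (extend (extend (extend (extend (All.∷ʳ⁺ pencil-of-r line₀₅₇)
            pt₀ pt₆ (λ ()) refl) pt₁ pt₈ (λ ()) refl) pt₂ pt₇ (λ ()) refl)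
            pt₂ pt₈ (λ ()) refl) pt₄ pt₅ (λ ()) refl) pt₆ pt₇ (λ ()) refl

    -- third p qr is u or v, up to swapping the two; were it pqr, no point could be third p u.
    frame : ∀ {u v} → u ∈ Y → v ∈ Y → All (u ≢_) seven → All (v ≢_) seven → u ≢ v → AffineCoordinates p q
    frame u∈Y v∈Y u∉seven v∉seven u≢v = by-cases (third-candidate {a = pt₀} {b = pt₅} pencil-of-r (λ ()))
      where
      open Frame u∈Y v∈Y u∉seven v∉seven u≢v
      by-cases : ∃[ k ] (σ k ≡ third p qr × k ∈ₗ pt₆ ∷ pt₇ ∷ pt₈ ∷ []) → AffineCoordinates p q
      by-cases (k , σk≡ , here refl) =
        ⊥-elim (no-third {pencil-lines ∷ʳ (pt₀ , pt₅ , pt₆)} {pt₀} {pt₇}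
                  (All.∷ʳ⁺ pencil-of-r (collinear-third {pt₀} {pt₅} {pt₆} (λ ()) σk≡)) (λ ()) refl)
      by-cases (k , σk≡ , there (here refl)) = complete (collinear-third {pt₀} {pt₅} {pt₇} (λ ()) σk≡)
      by-cases (k , σk≡ , there (there (here refl))) =
        Frame.complete v∈Y u∈Y v∉seven u∉seven (u≢v ∘ sym) (collinear-third {pt₀} {pt₅} {pt₈} (λ ()) σk≡)

  affine-coordinates : ∀ {p q} → p ∈ Y → q ∈ Y → p ≢ q → AffineCoordinates p q
  affine-coordinates {p} {q} p∈Y q∈Y p≢q =
    pick-r (length<∣∣⇒∃∉ Y (p ∷ q ∷ third p q ∷ []) (fewer-than-9 (toWitness {a? = 3 <? 9} _)))
    where
    pick-r : ∃[ r ] (r ∈ Y × All (r ≢_) (p ∷ q ∷ third p q ∷ [])) → AffineCoordinates p q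
    pick-r (r , r∈Y , r∉pq) = pick-u (length<∣∣⇒∃∉ Y seven (fewer-than-9 (toWitness {a? = 7 <? 9} _)))
      where
      open Construction p∈Y q∈Y r∈Y p≢q r∉pq
      pick-u : ∃[ u ] (u ∈ Y × All (u ≢_) seven) → AffineCoordinates p q
      pick-u (u , u∈Y , u∉seven) =
        pick-v (length<∣∣⇒∃∉ Y (u ∷ seven) (fewer-than-9 (toWitness {a? = 8 <? 9} _)))
        where
        pick-v : ∃[ v ] (v ∈ Y × All (v ≢_) (u ∷ seven)) → AffineCoordinates p q
        pick-v (v , v∈Y , v≢u ∷ v∉seven) = frame u∈Y v∈Y u∉seven v∉seven (v≢u ∘ sym)

-- Flowers

module _ {ℬ : Family} (ℬ-sts : IsSTS21 ℬ) where
  private module B = SteinerTripleSystem ℬ-sts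

  module _ {X : PSet} {𝒞 : Family} (𝒞-sts : IsSTS X 𝒞) {x y : Pt} (x∈X : x ∈ X) (y∈X : y ∈ X)
           (x≢y : x ≢ y) where
    private module C = SteinerTripleSystem 𝒞-sts

    closed-if-inherited : (∀ t → 𝒞 t → x ∈ t → ℬ t) → B.third x y ∈ X
    closed-if-inherited 𝒞⊑ℬ =
      subst (_∈ X) (sym (third-inherited 𝒞-sts ℬ-sts x∈X y∈X x≢y 𝒞⊑ℬ)) (C.third∈ x∈X y∈X x≢y)

  sub-closed : ∀ {X x y} → HasSubSTS9 ℬ X → x ∈ X → y ∈ X → x ≢ y → B.third x y ∈ X
  sub-closed (_ , 𝒞 , 𝒞⊑ℬ , 𝒞-sts) x∈X y∈X x≢y = closed-if-inherited 𝒞-sts x∈X y∈X x≢y λ t t∈𝒞 _ → 𝒞⊑ℬ t t∈𝒞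

  almost-closed : ∀ {X T x y} → HasAlmostSubSTS9 ℬ X T → x ∈ X → y ∈ X → x ≢ y → x ∉ T → B.third x y ∈ X
  almost-closed (_ , 𝒞 , 𝒞-sts , _ , 𝒞∖T⊑ℬ) x∈X y∈X x≢y x∉T =
    closed-if-inherited 𝒞-sts x∈X y∈X x≢y λ t t∈𝒞 x∈t → 𝒞∖T⊑ℬ t (t∈𝒞 , λ { refl → x∉T x∈t })

  sub⇒almost : ∀ {X} → HasSubSTS9 ℬ X → ∃[ T ] HasAlmostSubSTS9 ℬ X T
  sub⇒almost {X} (∣X∣≡9 , 𝒞 , 𝒞⊑ℬ , 𝒞-sts)
    with two-points X (subst (1 <_) (sym ∣X∣≡9) (s≤s (s≤s z≤n)))
  ... | x , y , x∈X , y∈X , x≢y with proj₁ (proj₂ 𝒞-sts x y x∈X y∈X x≢y)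
  ... | T , T∈𝒞 , _ = T , ∣X∣≡9 , 𝒞 , 𝒞-sts , T∈𝒞 , λ t (t∈𝒞 , _) → 𝒞⊑ℬ t t∈𝒞

  almost⇒sub : ∀ {X T} → HasAlmostSubSTS9 ℬ X T → (∀ {x y} → x ∈ T → y ∈ T → x ≢ y → B.third x y ∈ X) →
               HasSubSTS9 ℬ X
  almost⇒sub {X} {T} (∣X∣≡9 , 𝒞 , 𝒞-sts , T∈𝒞 , 𝒞∖T⊑ℬ) T-closed = ∣X∣≡9 , 𝒞 , 𝒞⊑ℬ , 𝒞-sts
    where
    module C = SteinerTripleSystem 𝒞-sts
    T-block : ℬ T
    T-block with two-points T (subst (1 <_) (sym (C.block-size T∈𝒞)) (s≤s (s≤s z≤n)))
    ... | d₁ , d₂ , d₁∈T , d₂∈T , d₁≢d₂ with B.third-spec ∈⊤ ∈⊤ d₁≢d₂ | B.third d₁ d₂ ∈? T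
    ... | (b , b∈ℬ , d₁∈b , d₂∈b , w∈b) , w≢d₁ , w≢d₂ | yes w∈T = subst ℬ b≡T b∈ℬ
      where
      b⊆T : b ⊆ T
      b⊆T x∈b with B.block-members b∈ℬ d₁∈b d₂∈b w∈b d₁≢d₂ (w≢d₁ ∘ sym) (w≢d₂ ∘ sym) x∈b
      ... | inj₁ refl = d₁∈T
      ... | inj₂ (inj₁ refl) = d₂∈T
      ... | inj₂ (inj₂ refl) = w∈T
      b≡T : b ≡ T
      b≡T = ⊆∧∣∣≤⇒≡ b⊆T (≤-reflexive (trans (C.block-size T∈𝒞) (sym (B.block-size b∈ℬ))))
    ... | _ , w≢d₁ , w≢d₂ | no w∉T = contradiction w∈T w∉T
      where
      -- Outside T the ℬ-blocks and 𝒞-blocks agree, so w would lie on the 𝒞-block T through d₁ and d₂.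
      w = B.third d₁ d₂
      w∈X = T-closed d₁∈T d₂∈T d₁≢d₂
      d₁∈X = C.block⊆ T∈𝒞 d₁∈T
      d₂∈X = C.block⊆ T∈𝒞 d₂∈T
      C-w-d₁ : C.third w d₁ ≡ d₂
      C-w-d₁ = trans (sym (third-inherited 𝒞-sts ℬ-sts w∈X d₁∈X w≢d₁ blocks-through-w))
                     (trans (B.third-comm ∈⊤ ∈⊤ w≢d₁) (B.third-involutive ∈⊤ ∈⊤ d₁≢d₂))
        where
        blocks-through-w : ∀ t → 𝒞 t → w ∈ t → ℬ t
        blocks-through-w t t∈𝒞 w∈t = 𝒞∖T⊑ℬ t (t∈𝒞 , λ { refl → w∉T w∈t })
      w∈T : w ∈ T
      w∈T = subst (_∈ T)
                  (C.third-move d₁∈X w∈X (w≢d₁ ∘ sym) (trans (C.third-comm d₁∈X w∈X (w≢d₁ ∘ sym)) C-w-d₁))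
                  (C.third∈block T∈𝒞 d₁∈T d₂∈T d₁≢d₂)
    𝒞⊑ℬ : 𝒞 ⊑ ℬ
    𝒞⊑ℬ t t∈𝒞 with ≡-dec _≟ᵇ_ t T
    ... | yes refl = T-block
    ... | no t≢T = 𝒞∖T⊑ℬ t (t∈𝒞 , t≢T)

  module Flower {A B C D : PSet} (flower : IsFlower ℬ A B C D) where

    Petal : Fin 3 → PSet
    Petal zero = A
    Petal (suc zero) = B
    Petal (suc (suc zero)) = C

    Part : Fin 3 → PSet
    Part i = Petal i ∪ D

    private
      partition = proj₁ flower

    stem-size : ∣ D ∣ ≡ 3
    stem-size = let (_ , _ , _ , _ , _ , _ , _ , _ , _ , _ , ∣D∣) = partition in ∣D∣

    petal-size : ∀ i → ∣ Petal i ∣ ≡ 6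
    petal-size zero = let (_ , _ , _ , _ , _ , _ , _ , ∣A∣ , _) = partition in ∣A∣
    petal-size (suc zero) = let (_ , _ , _ , _ , _ , _ , _ , _ , ∣B∣ , _) = partition in ∣B∣
    petal-size (suc (suc zero)) = let (_ , _ , _ , _ , _ , _ , _ , _ , _ , ∣C∣ , _) = partition in ∣C∣

    petal-∉-stem : ∀ i {x} → x ∈ Petal i → x ∉ D
    petal-∉-stem zero = let (_ , _ , _ , A∩D , _) = partition in disjoint A∩D
    petal-∉-stem (suc zero) = let (_ , _ , _ , _ , _ , B∩D , _) = partition in disjoint B∩D
    petal-∉-stem (suc (suc zero)) = let (_ , _ , _ , _ , _ , _ , C∩D , _) = partition in disjoint C∩D

    petals-disjoint : ∀ i j {x} → x ∈ Petal i → x ∈ Petal j → i ≡ j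
    petals-disjoint i j x∈Pᵢ x∈Pⱼ with partition
    ... | (_ , A∩B , A∩C , _ , B∩C , _) = go i j x∈Pᵢ x∈Pⱼ
      where
      go : ∀ i j {x} → x ∈ Petal i → x ∈ Petal j → i ≡ j
      go zero zero _ _ = refl
      go (suc zero) (suc zero) _ _ = refl
      go (suc (suc zero)) (suc (suc zero)) _ _ = refl
      go zero (suc zero) x∈A x∈B = ⊥-elim (disjoint A∩B x∈A x∈B)
      go zero (suc (suc zero)) x∈A x∈C = ⊥-elim (disjoint A∩C x∈A x∈C)
      go (suc zero) (suc (suc zero)) x∈B x∈C = ⊥-elim (disjoint B∩C x∈B x∈C)
      go (suc zero) zero x∈B x∈A = ⊥-elim (disjoint A∩B x∈A x∈B)
      go (suc (suc zero)) zero x∈C x∈A = ⊥-elim (disjoint A∩C x∈A x∈C)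
      go (suc (suc zero)) (suc zero) x∈C x∈B = ⊥-elim (disjoint B∩C x∈B x∈C)

    covering : ∀ x → x ∈ D ⊎ ∃[ i ] x ∈ Petal i
    covering x with partition
    ... | (cover , _) with x∈p∪q⁻ A _ (subst (x ∈_) (sym cover) ∈⊤)
    ... | inj₁ x∈A = inj₂ (zero , x∈A)
    ... | inj₂ x∈B∪C∪D with x∈p∪q⁻ B _ x∈B∪C∪D
    ... | inj₁ x∈B = inj₂ (suc zero , x∈B)
    ... | inj₂ x∈C∪D with x∈p∪q⁻ C D x∈C∪D
    ... | inj₁ x∈C = inj₂ (suc (suc zero) , x∈C)
    ... | inj₂ x∈D = inj₁ x∈D

    part : ∀ i → HasSubSTS9 ℬ (Part i) ⊎ HasAlmostSubSTS9 ℬ (Part i) D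
    part zero with proj₂ flower
    ... | inj₁ (sub , _) = inj₁ sub
    ... | inj₂ (inj₁ (almost , _)) = inj₂ almost
    ... | inj₂ (inj₂ (almost , _)) = inj₂ almost
    part (suc zero) with proj₂ flower
    ... | inj₁ (_ , almost , _) = inj₂ almost
    ... | inj₂ (inj₁ (_ , sub , _)) = inj₁ sub
    ... | inj₂ (inj₂ (_ , almost , _)) = inj₂ almost
    part (suc (suc zero)) with proj₂ flower
    ... | inj₁ (_ , _ , almost) = inj₂ almost
    ... | inj₂ (inj₁ (_ , _ , almost)) = inj₂ almost
    ... | inj₂ (inj₂ (_ , _ , sub)) = inj₁ sub

    label : Pt → Label
    label x with covering x
    ... | inj₁ _ = stem
    ... | inj₂ (i , _) = petal i

    label-stem : ∀ {x} → x ∈ D → label x ≡ stem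
    label-stem {x} x∈D with covering x
    ... | inj₁ _ = refl
    ... | inj₂ (i , x∈Pᵢ) = contradiction x∈D (petal-∉-stem i x∈Pᵢ)

    label-petal : ∀ {x i} → x ∈ Petal i → label x ≡ petal i
    label-petal {x} {i} x∈Pᵢ with covering x
    ... | inj₁ x∈D = contradiction x∈D (petal-∉-stem i x∈Pᵢ)
    ... | inj₂ (j , x∈Pⱼ) = cong petal (petals-disjoint j i x∈Pⱼ x∈Pᵢ)

    label≡stem : ∀ {x} → label x ≡ stem → x ∈ D
    label≡stem {x} e with covering x
    ... | inj₁ x∈D = x∈D

    label≡petal : ∀ {x i} → label x ≡ petal i → x ∈ Petal i
    label≡petal {x} e with covering x
    label≡petal {x} refl | inj₂ (i , x∈Pᵢ) = x∈Pᵢ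

    ∈Part⇒InPart : ∀ {x i} → x ∈ Part i → InPart i (label x)
    ∈Part⇒InPart {x} {i} x∈Part with x∈p∪q⁻ (Petal i) D x∈Part
    ... | inj₁ x∈Pᵢ = inj₂ (label-petal x∈Pᵢ)
    ... | inj₂ x∈D = inj₁ (label-stem x∈D)

    InPart⇒∈Part : ∀ {x i} → InPart i (label x) → x ∈ Part i
    InPart⇒∈Part {i = i} (inj₁ x-stem) = q⊆p∪q (Petal i) D (label≡stem x-stem)
    InPart⇒∈Part (inj₂ x-petal) = p⊆p∪q D (label≡petal x-petal)

    part-closed : ∀ i {x y} → x ∈ Part i → y ∈ Part i → x ≢ y → x ∉ D → B.third x y ∈ Part i
    part-closed i x∈Part y∈Part x≢y x∉D with part i
    ... | inj₁ sub = sub-closed sub x∈Part y∈Part x≢y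
    ... | inj₂ almost = almost-closed almost x∈Part y∈Part x≢y x∉D

    third-closed : ∀ {x y} → x ≢ y → Closed (label x) (label y) (label (B.third x y))
    third-closed {x} x≢y {i} x-petal y-in-part =
      ∈Part⇒InPart (part-closed i (p⊆p∪q D x∈Pᵢ) (InPart⇒∈Part y-in-part) x≢y (petal-∉-stem i x∈Pᵢ))
      where
      x∈Pᵢ = label≡petal x-petal

    block-closed : ∀ {t x y w} → ℬ t → x ∈ t → y ∈ t → w ∈ t → x ≢ y → x ≢ w → y ≢ w →
                   BlockClosed (label x) (label y) (label w)
    block-closed {t} t∈ℬ x∈t y∈t w∈t x≢y x≢w y≢w =
      closed x∈t y∈t w∈t x≢y x≢w y≢w , closed x∈t w∈t y∈t x≢w x≢y (y≢w ∘ sym) ,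
      closed y∈t x∈t w∈t (x≢y ∘ sym) y≢w x≢w , closed y∈t w∈t x∈t y≢w (x≢y ∘ sym) (x≢w ∘ sym) ,
      closed w∈t x∈t y∈t (x≢w ∘ sym) (y≢w ∘ sym) x≢y , closed w∈t y∈t x∈t (y≢w ∘ sym) (x≢w ∘ sym) (x≢y ∘ sym)
      where
      closed : ∀ {a b c} → a ∈ t → b ∈ t → c ∈ t → a ≢ b → a ≢ c → b ≢ c →
               Closed (label a) (label b) (label c)
      closed a∈t b∈t c∈t a≢b a≢c b≢c =
        subst (Closed _ _ ∘ label) (B.third-unique t∈ℬ a∈t b∈t c∈t a≢b (a≢c ∘ sym) (b≢c ∘ sym))
              (third-closed a≢b)

    module OnAlmostSub {Y M : PSet} {𝒦 : Family} (∣Y∣≡9 : ∣ Y ∣ ≡ 9) (𝒦-sts : IsSTS Y 𝒦) (M∈𝒦 : 𝒦 M)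
                       (𝒦∖M⊑ℬ : (𝒦 ∖₁ M) ⊑ ℬ) {p q : Pt} (p∈M : p ∈ M) (q∈M : q ∈ M) (p≢q : p ≢ q)
                       (coordinates : AffinePlane.AffineCoordinates 𝒦-sts ∣Y∣≡9 p q) where
      private
        module K = SteinerTripleSystem 𝒦-sts
        open AffinePlane 𝒦-sts ∣Y∣≡9
        open AffineCoordinates coordinates

        labels : Vec Label 9
        labels = tabulate (label ∘ σ)

        labels-at : ∀ i → lookup labels i ≡ label (σ i)
        labels-at = lookup∘tabulate (label ∘ σ)

        σ∈M⇒special : ∀ {k} → σ k ∈ M → k ∈ᵗ special
        σ∈M⇒special σk∈M with K.block-members M∈𝒦 p∈M q∈M (K.third∈block M∈𝒦 p∈M q∈M p≢q) p≢q
                                (K.third≢ˡ p∈Y q∈Y p≢q ∘ sym) (K.third≢ʳ p∈Y q∈Y p≢q ∘ sym) σk∈M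
          where
          p∈Y = K.block⊆ M∈𝒦 p∈M
          q∈Y = K.block⊆ M∈𝒦 q∈M
        ... | inj₁ σk≡p = inj₁ (σ-injective (trans σk≡p (sym σ₀)))
        ... | inj₂ (inj₁ σk≡q) = inj₂ (inj₁ (σ-injective (trans σk≡q (sym σ₁))))
        ... | inj₂ (inj₂ σk≡pq) = inj₂ (inj₂ (σ-injective (trans σk≡pq (sym σ₂))))

        line-ok : ∀ {t} → Collinear σ t → Distinct t × OffSpecial t → T (lineOk labels t)
        line-ok {a , b , c} (u , u∈𝒦 , a∈u , b∈u , c∈u) ((a≢b , a≢c , b≢c) , off-special)
          rewrite labels-at a | labels-at b | labels-at c =
          lineOkᵇ-intro _ _ _ (block-closed u∈ℬ a∈u b∈u c∈u (σ-≢ a≢b) (σ-≢ a≢c) (σ-≢ b≢c))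
          where
          σ-≢ : ∀ {i j} → i ≢ j → σ i ≢ σ j
          σ-≢ i≢j = i≢j ∘ σ-injective
          u∈ℬ : ℬ u
          u∈ℬ = 𝒦∖M⊑ℬ u (u∈𝒦 , λ { refl →
                  off-special (σ∈M⇒special a∈u , σ∈M⇒special b∈u , σ∈M⇒special c∈u) })

        lines-ok : All (T ∘ lineOk labels) planeLines
        lines-ok with lines
        ... | _ ∷ plane-collinear = All.zipWith (λ (collinear , valid) → line-ok collinear valid)
                                                (plane-collinear , planeLines-valid)

        few-stems : length (stems labels) ≤ 3
        few-stems = begin
          length (stems labels)          ≡⟨ length-map σ (stems labels) ⟨
          length (map σ (stems labels))  ≤⟨ unique⇒length≤∣∣ stem-points-unique
                                               (All.map⁺ (All.tabulate stem∈D)) ⟩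
          ∣ D ∣                          ≡⟨ stem-size ⟩
          3                              ∎
          where
          open ≤-Reasoning
          stem-points-unique : Unique (map σ (stems labels))
          stem-points-unique = map⁺ σ-injective (filter⁺ (λ i → isStem? (lookup labels i)) (allFin⁺ 9))
          stem∈D : ∀ {i} → i ∈ₗ stems labels → σ i ∈ D
          stem∈D {i} i∈stems = label≡stem (trans (sym (labels-at i))
            (proj₂ (∈-filter⁻ (λ i → isStem? (lookup labels i)) {xs = allFin 9} i∈stems)))

      constant : ∀ {z} → z ∈ Y → z ∈ D → ∀ {x y} → x ∈ Y → y ∈ Y → x ∉ D → y ∉ D → label x ≡ label y
      constant z∈Y z∈D x∈Y y∈Y x∉D y∉D with σ-onto z∈Y | σ-onto x∈Y | σ-onto y∈Y
      ... | k , refl | i , refl | j , refl =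
        trans (sym (labels-at i))
          (trans (uniform-labelling labels lines-ok (k , trans (labels-at k) (label-stem z∈D)) few-stems i j
                    (off-stem i x∉D) (off-stem j y∉D))
                 (labels-at j))
        where
        off-stem : ∀ i → σ i ∉ D → lookup labels i ≢ stem
        off-stem i σi∉D i-stem = σi∉D (label≡stem (trans (sym (labels-at i)) i-stem))

    label-constant : ∀ {Y M} → HasAlmostSubSTS9 ℬ Y M → ∀ {z} → z ∈ Y → z ∈ D →
                     ∀ {x y} → x ∈ Y → y ∈ Y → x ∉ D → y ∉ D → label x ≡ label y
    label-constant {M = M} (∣Y∣≡9 , _ , 𝒦-sts , M∈𝒦 , 𝒦∖M⊑ℬ)
      with two-points M (subst (1 <_) (sym (SteinerTripleSystem.block-size 𝒦-sts M∈𝒦)) (s≤s (s≤s z≤n)))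
    ... | p , q , p∈M , q∈M , p≢q = OnAlmostSub.constant ∣Y∣≡9 𝒦-sts M∈𝒦 𝒦∖M⊑ℬ p∈M q∈M p≢q
      (AffinePlane.affine-coordinates 𝒦-sts ∣Y∣≡9 (K.block⊆ M∈𝒦 p∈M) (K.block⊆ M∈𝒦 q∈M) p≢q)
      where module K = SteinerTripleSystem 𝒦-sts

    part-almost : ∀ i → ∃[ T ] HasAlmostSubSTS9 ℬ (Part i) T
    part-almost i with part i
    ... | inj₁ sub = sub⇒almost sub
    ... | inj₂ almost = D , almost

    part-of : ∀ x → ∃[ i ] x ∈ Part i
    part-of x with covering x
    ... | inj₁ x∈D = zero , q⊆p∪q A D x∈D
    ... | inj₂ (i , x∈Pᵢ) = i , p⊆p∪q D x∈Pᵢ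

    stem-point : ∃[ x ] x ∈ D
    stem-point with length<∣∣⇒∃∉ D [] (subst (0 <_) (sym stem-size) (s≤s z≤n))
    ... | x , x∈D , _ = x , x∈D

    petal-point : ∀ i → ∃[ x ] x ∈ Petal i
    petal-point i with length<∣∣⇒∃∉ (Petal i) [] (subst (0 <_) (sym (petal-size i)) (s≤s z≤n))
    ... | x , x∈Pᵢ , _ = x , x∈Pᵢ

    Petal-∈₃ : ∀ i → Petal i ∈₃ (A , B , C)
    Petal-∈₃ zero = inj₁ refl
    Petal-∈₃ (suc zero) = inj₂ (inj₁ refl)
    Petal-∈₃ (suc (suc zero)) = inj₂ (inj₂ refl)

    ∈₄⇒ : ∀ {X} → X ∈₄ (A , B , C , D) → X ≡ D ⊎ ∃[ i ] X ≡ Petal i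
    ∈₄⇒ (inj₁ X≡A) = inj₂ (zero , X≡A)
    ∈₄⇒ (inj₂ (inj₁ X≡B)) = inj₂ (suc zero , X≡B)
    ∈₄⇒ (inj₂ (inj₂ (inj₁ X≡C))) = inj₂ (suc (suc zero) , X≡C)
    ∈₄⇒ (inj₂ (inj₂ (inj₂ X≡D))) = inj₁ X≡D

    ∈₄⇐ : ∀ {X} → X ≡ D ⊎ ∃[ i ] X ≡ Petal i → X ∈₄ (A , B , C , D)
    ∈₄⇐ (inj₁ X≡D) = inj₂ (inj₂ (inj₂ X≡D))
    ∈₄⇐ (inj₂ (zero , X≡A)) = inj₁ X≡A
    ∈₄⇐ (inj₂ (suc zero , X≡B)) = inj₂ (inj₁ X≡B)
    ∈₄⇐ (inj₂ (suc (suc zero) , X≡C)) = inj₂ (inj₂ (inj₁ X≡C))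

    petal-of : ∀ {x} → x ∉ D → ∃[ i ] x ∈ Petal i
    petal-of {x} x∉D with covering x
    ... | inj₁ x∈D = contradiction x∈D x∉D
    ... | inj₂ in-petal = in-petal

    part-size : ∀ i → ∣ Part i ∣ ≡ 9
    part-size i = proj₁ (proj₂ (part-almost i))

-- Two flowers

module TwoFlowers {ℬ : Family} (ℬ-sts : IsSTS21 ℬ) {A B C D A′ B′ C′ D′ : PSet}
                  (flower : IsFlower ℬ A B C D) (flower′ : IsFlower ℬ A′ B′ C′ D′) where
  private module B = SteinerTripleSystem ℬ-sts
  open Flower ℬ-sts flower
  module F′ = Flower ℬ-sts flower′

  label-constant′ : ∀ i′ {z} → z ∈ F′.Part i′ → z ∈ D →
                    ∀ {x y} → x ∈ F′.Part i′ → y ∈ F′.Part i′ → x ∉ D → y ∉ D → label x ≡ label y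
  label-constant′ i′ = label-constant (proj₂ (F′.part-almost i′))

  module StemsMeet {z : Pt} (z∈D : z ∈ D) (z∈D′ : z ∈ D′) where

    D′⊆D : D′ ⊆ D
    D′⊆D {q} q∈D′ with q ∈? D
    ... | yes q∈D = q∈D
    ... | no q∉D with petal-of q∉D
    ... | i , q∈Pᵢ with another i
    ... | j , j≢i with petal-point j
    ... | u , u∈Pⱼ with F′.part-of u
    ... | i′ , u∈Y = contradiction (petal-injective (begin
            petal j  ≡⟨ label-petal u∈Pⱼ ⟨
            label u  ≡⟨ label-constant′ i′ (q⊆p∪q _ D′ z∈D′) z∈D u∈Y (q⊆p∪q _ D′ q∈D′)
                                          (petal-∉-stem j u∈Pⱼ) q∉D ⟩
            label q  ≡⟨ label-petal q∈Pᵢ ⟩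
            petal i  ∎)) j≢i
      where open ≡-Reasoning

    D′≡D : D′ ≡ D
    D′≡D = ⊆∧∣∣≤⇒≡ D′⊆D (≤-reflexive (trans stem-size (sym F′.stem-size)))

    petal′-is-petal : ∀ i′ → ∃[ i ] F′.Petal i′ ≡ Petal i
    petal′-is-petal i′ with F′.petal-point i′
    ... | x , x∈P′ with petal-of (subst (x ∉_) D′≡D (F′.petal-∉-stem i′ x∈P′))
    ... | i , x∈Pᵢ = i , ⊆∧∣∣≤⇒≡ P′⊆Pᵢ (≤-reflexive (trans (petal-size i) (sym (F′.petal-size i′))))
      where
      P′⊆Pᵢ : F′.Petal i′ ⊆ Petal i
      P′⊆Pᵢ {y} y∈P′ = label≡petal (begin
        label y  ≡⟨ label-constant′ i′ (q⊆p∪q _ D′ z∈D′) z∈D (p⊆p∪q D′ y∈P′) (p⊆p∪q D′ x∈P′)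
                                    (∉D y∈P′) (∉D x∈P′) ⟩
        label x  ≡⟨ label-petal x∈Pᵢ ⟩
        petal i  ∎)
        where
        open ≡-Reasoning
        ∉D : ∀ {w} → w ∈ F′.Petal i′ → w ∉ D
        ∉D w∈P′ = subst (_ ∉_) D′≡D (F′.petal-∉-stem i′ w∈P′)

    petal-is-petal′ : ∀ i → ∃[ i′ ] Petal i ≡ F′.Petal i′
    petal-is-petal′ i =
      let x , x∈Pᵢ = petal-point i
          i′ , x∈P′ = F′.petal-of (subst (x ∉_) (sym D′≡D) (petal-∉-stem i x∈Pᵢ))
          j , P′≡Pⱼ = petal′-is-petal i′
          i≡j = petals-disjoint i j x∈Pᵢ (subst (x ∈_) P′≡Pⱼ x∈P′)
      in i′ , sym (subst (λ k → F′.Petal i′ ≡ Petal k) (sym i≡j) P′≡Pⱼ)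

    same-parts : SameParts (A , B , C , D) (A′ , B′ , C′ , D′)
    same-parts X = F′.∈₄⇐ ∘ to ∘ ∈₄⇒ , ∈₄⇐ ∘ from ∘ F′.∈₄⇒
      where
      to : X ≡ D ⊎ ∃[ i ] X ≡ Petal i → X ≡ D′ ⊎ ∃[ i′ ] X ≡ F′.Petal i′
      to (inj₁ X≡D) = inj₁ (trans X≡D (sym D′≡D))
      to (inj₂ (i , X≡Pᵢ)) = let i′ , Pᵢ≡P′ = petal-is-petal′ i in inj₂ (i′ , trans X≡Pᵢ Pᵢ≡P′)
      from : X ≡ D′ ⊎ ∃[ i′ ] X ≡ F′.Petal i′ → X ≡ D ⊎ ∃[ i ] X ≡ Petal i
      from (inj₁ X≡D′) = inj₁ (trans X≡D′ D′≡D)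
      from (inj₂ (i′ , X≡P′)) = let i , P′≡Pᵢ = petal′-is-petal i′ in inj₂ (i , trans X≡P′ P′≡Pᵢ)

  module StemsDisjoint (D∩D′≡⊥ : D ∩ D′ ≡ ⊥) where

    -- The part of the second flower through a point of D lies, off D, in a single petal.
    common-part : ∃[ i ] ∃[ i′ ] F′.Part i′ ≡ Part i
    common-part with stem-point | F′.stem-point
    ... | d , d∈D | p′ , p′∈D′ with F′.part-of d | petal-of p′∉D
      where
      p′∉D : p′ ∉ D
      p′∉D p′∈D = disjoint D∩D′≡⊥ p′∈D p′∈D′
    ... | i′ , d∈Y | i , p′∈Pᵢ =
      i , i′ , ⊆∧∣∣≤⇒≡ Y⊆Partᵢ (≤-reflexive (trans (part-size i) (sym (F′.part-size i′))))
      where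
      Y⊆Partᵢ : F′.Part i′ ⊆ Part i
      Y⊆Partᵢ {y} y∈Y with y ∈? D
      ... | yes y∈D = q⊆p∪q (Petal i) D y∈D
      ... | no y∉D = p⊆p∪q D (label≡petal (trans
              (label-constant′ i′ d∈Y d∈D y∈Y (q⊆p∪q _ D′ p′∈D′) y∉D (petal-∉-stem i p′∈Pᵢ))
              (label-petal p′∈Pᵢ)))

    common-part-sub : ∀ {i i′} → F′.Part i′ ≡ Part i → HasSubSTS9 ℬ (Part i)
    common-part-sub {i} {i′} Y≡Partᵢ with part i
    ... | inj₁ sub = sub
    ... | inj₂ almost = almost⇒sub ℬ-sts almost D-closed
      where
      ∈Y : ∀ {w} → w ∈ D → w ∈ F′.Part i′
      ∈Y w∈D = subst (_ ∈_) (sym Y≡Partᵢ) (q⊆p∪q (Petal i) D w∈D)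
      D-closed : ∀ {x y} → x ∈ D → y ∈ D → x ≢ y → B.third x y ∈ Part i
      D-closed x∈D y∈D x≢y =
        subst (_ ∈_) Y≡Partᵢ (F′.part-closed i′ (∈Y x∈D) (∈Y y∈D) x≢y (disjoint D∩D′≡⊥ x∈D))

    conclusion : ∃[ E ] ∃[ E′ ] (E ∈₃ (A , B , C) × E′ ∈₃ (A′ , B′ , C′) ×
                                 D ∪ E ≡ D′ ∪ E′ × HasSubSTS9 ℬ (D ∪ E))
    conclusion with common-part
    ... | i , i′ , Y≡Partᵢ =
      Petal i , F′.Petal i′ , Petal-∈₃ i , F′.Petal-∈₃ i′ ,
      trans (∪-comm D (Petal i)) (trans (sym Y≡Partᵢ) (∪-comm (F′.Petal i′) D′)) ,
      subst (HasSubSTS9 ℬ) (∪-comm (Petal i) D) (common-part-sub Y≡Partᵢ)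

  theorem : ¬ SameParts (A , B , C , D) (A′ , B′ , C′ , D′) →
            (D ∩ D′ ≡ ⊥) × (∃[ E ] ∃[ E′ ] (E ∈₃ (A , B , C) × E′ ∈₃ (A′ , B′ , C′) ×
                                            D ∪ E ≡ D′ ∪ E′ × HasSubSTS9 ℬ (D ∪ E)))
  theorem different with nonempty? (D ∩ D′)
  ... | yes (z , z∈D∩D′) = contradiction (StemsMeet.same-parts z∈D z∈D′) different
    where
    z∈D = proj₁ (x∈p∩q⁻ D D′ z∈D∩D′)
    z∈D′ = proj₂ (x∈p∩q⁻ D D′ z∈D∩D′)
  ... | no stems-disjoint = D∩D′≡⊥ , StemsDisjoint.conclusion D∩D′≡⊥
    where
    D∩D′≡⊥ = Empty-unique stems-disjoint

lemma4 : (ℬ : Family) → IsSTS21 ℬ →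
    (A B C D A' B' C' D' : PSet) →
    IsFlower ℬ A B C D → IsFlower ℬ A' B' C' D' →
    ¬ SameParts (A , B , C , D) (A' , B' , C' , D') →
    (D ∩ D' ≡ ⊥) ×
    (∃[ E ] ∃[ E' ] (E ∈₃ (A , B , C) × E' ∈₃ (A' , B' , C') ×
      D ∪ E ≡ D' ∪ E' × HasSubSTS9 ℬ (D ∪ E)))
lemma4 ℬ ℬ-sts A B C D A' B' C' D' flower flower' = TwoFlowers.theorem ℬ-sts flower flower'
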